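{- Let $q\ge2$ be a prime power, $V$ an $n$-dimensional vector space over $\mathbb{F}_q$, and $n,k,t,s$ positive integers with $k\ge t+1$ and $n\ge 2k+s-1$. Suppose that $\mathcal{F},\mathcal{G}\subseteq{V\brack k}$ are non-empty maximal $s$-almost cross-$t$-intersecting families. If $\tau_t(\mathcal{F})\le k$ and $\tau_t(\mathcal{G})\le k$, then $\mathcal{T}(\mathcal{F})$ and $\mathcal{T}(\mathcal{G})$ are cross-$t$-intersecting, i.e. $\dim(T_f\cap T_g)\ge t$ for all $T_f\in\mathcal{T}(\mathcal{F})$ and $T_g\in\mathcal{T}(\mathcal{G})$.
   Context: ${V\brack k}$ is the set of $k$-dimensional subspaces of $V$. $\mathcal{D}_{\mathcal{G}}(F;t)=\{G\in\mathcal{G}:\dim(G\cap F)<t\}$; $\mathcal{F},\mathcal{G}$ are $s$-almost cross-$t$-intersecting if $|\mathcal{D}_{\mathcal{G}}(F;t)|\le s$ for all $F\in\mathcal{F}$ and $|\mathcal{D}_{\mathcal{F}}(G;t)|\le s$ for all $G\in\mathcal{G}$. The pair is maximal if there is no pair $(\mathcal{F}',\mathcal{G}')\ne(\mathcal{F},\mathcal{G})$ of $s$-almost cross-$t$-intersecting families in ${V\brack k}$ with $\mathcal{F}\subseteq\mathcal{F}'$ and $\mathcal{G}\subseteq\mathcal{G}'$. A subspace $T$ of $V$ is a $t$-cover of a family $\mathcal{F}$ if $\dim(T\cap F)\ge t$ for all $F\in\mathcal{F}$; $\tau_t(\mathcal{F})$ is the minimum dimension of a $t$-cover of $\mathcal{F}$,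 and $\mathcal{T}(\mathcal{F})$ is the set of all $t$-covers of $\mathcal{F}$ of dimension $\tau_t(\mathcal{F})$. -}

module Defs where

open import Level using (0ℓ)
open import Data.Nat using (ℕ; zero; suc; _≤_; _<_; _^_)
open import Data.Nat.Primality using (Prime)
open import Data.Fin using (Fin; zero; suc)
open import Data.Product using (Σ; ∃; _×_; _,_)
open import Data.List using (List; length)
open import Data.List.Relation.Unary.All using (All)
open import Data.List.Relation.Unary.AllPairs using (AllPairs)
open import Relation.Nullary using (¬_)
open import Relation.Binary.PropositionalEquality using (_≡_; _≢_)
open import Algebra.Core using (Op₁; Op₂)
open import Algebra.Structures using (IsCommutativeRing)

IsPrimePower : ℕ → Set
IsPrimePower q = Σ ℕ λ p → Σ ℕ λ m → Prime p × 1 ≤ m × q ≡ p ^ m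

record Field : Set₁ where
  infixl 6 _+_
  infixl 7 _*_
  field
    Carrier : Set
    _+_ _*_ : Op₂ Carrier
    -_ : Op₁ Carrier
    0# 1# : Carrier
    isCommutativeRing : IsCommutativeRing _≡_ _+_ _*_ -_ 0# 1#
    0≢1 : 0# ≢ 1#
    inverse : ∀ x → x ≢ 0# → Σ Carrier λ y → x * y ≡ 1#

module LinAlg (𝔽 : Field) (n : ℕ) where
  open Field 𝔽

  V : Set
  V = Fin n → Carrier

  _≈V_ : V → V → Set
  u ≈V v = ∀ i → u i ≡ v i

  0V : V
  0V _ = 0#

  _+V_ : V → V → V
  (u +V v) i = u i + v i

  _·V_ : Carrier → V → V
  (a ·V v) i = a * v i

  record Subspace : Set₁ where
    field
      _∈S : V → Set
      ∈-resp : ∀ u v → u ≈V v → u ∈S → v ∈S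
      0∈ : 0V ∈S
      +∈ : ∀ u v → u ∈S → v ∈S → (u +V v) ∈S
      ·∈ : ∀ a v → v ∈S → (a ·V v) ∈S
  open Subspace public

  _≐_ : Subspace → Subspace → Set
  U ≐ W = ∀ v → (_∈S U v → _∈S W v) × (_∈S W v → _∈S U v)

  _∩_ : Subspace → Subspace → Subspace
  U ∩ W = record
    { _∈S = λ v → _∈S U v × _∈S W v
    ; ∈-resp = λ { u v e (p , q) → ∈-resp U u v e p , ∈-resp W u v e q }
    ; 0∈ = 0∈ U , 0∈ W
    ; +∈ = λ { u v (p , q) (p' , q') → +∈ U u v p p' , +∈ W u v q q' }
    ; ·∈ = λ { a v (p , q) → ·∈ U a v p , ·∈ W a v q }
    }

  lincomb : (m : ℕ) → (Fin m → Carrier) → (Fin m → V) → V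
  lincomb zero c b = 0V
  lincomb (suc m) c b = (c zero ·V b zero) +V lincomb m (λ i → c (suc i)) (λ i → b (suc i))

  LinIndep : (m : ℕ) → (Fin m → V) → Set
  LinIndep m b = ∀ c → lincomb m c b ≈V 0V → ∀ i → c i ≡ 0#

  IsBasis : Subspace → (m : ℕ) → (Fin m → V) → Set
  IsBasis U m b = (∀ i → _∈S U (b i)) × LinIndep m b
                × (∀ v → _∈S U v → Σ (Fin m → Carrier) λ c → lincomb m c b ≈V v)

  HasDim : Subspace → ℕ → Set
  HasDim U d = Σ (Fin d → V) λ b → IsBasis U d b

  DimGe : Subspace → ℕ → Set
  DimGe U t = Σ ℕ λ d → HasDim U d × t ≤ d

  DimLt : Subspace → ℕ → Set
  DimLt U t = Σ ℕ λ d → HasDim U d × d < t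

  Fam : Set₁
  Fam = Subspace → Set

  _⊆_ : Fam → Fam → Set₁
  𝓕 ⊆ 𝓖 = ∀ U → 𝓕 U → 𝓖 U

  IsFamily : ℕ → Fam → Set₁
  IsFamily k 𝓕 = (∀ U → 𝓕 U → HasDim U k) × (∀ U W → U ≐ W → 𝓕 U → 𝓕 W)

  -- a family has at most s members (counted up to ≐):
  -- every list of pairwise distinct members has length ≤ s
  AtMost : ℕ → Fam → Set₁
  AtMost s 𝓟 = ∀ (xs : List Subspace) → All 𝓟 xs
             → AllPairs (λ U W → ¬ (U ≐ W)) xs → length xs ≤ s

  D : Fam → Subspace → ℕ → Fam
  D 𝓖 F t G = 𝓖 G × DimLt (G ∩ F) t

  AlmostCrossInt : ℕ → ℕ → Fam → Fam → Set₁
  AlmostCrossInt s t 𝓕 𝓖 = (∀ F → 𝓕 F → AtMost s (D 𝓖 F t))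
                         × (∀ G → 𝓖 G → AtMost s (D 𝓕 G t))

  Maximal : ℕ → ℕ → ℕ → Fam → Fam → Set₁
  Maximal k s t 𝓕 𝓖 = ∀ 𝓕' 𝓖' → IsFamily k 𝓕' → IsFamily k 𝓖'
    → AlmostCrossInt s t 𝓕' 𝓖' → 𝓕 ⊆ 𝓕' → 𝓖 ⊆ 𝓖' → (𝓕' ⊆ 𝓕) × (𝓖' ⊆ 𝓖)

  NonEmpty : Fam → Set₁
  NonEmpty 𝓕 = Σ Subspace λ U → 𝓕 U

  IsCover : ℕ → Fam → Subspace → Set₁
  IsCover t 𝓕 T = ∀ F → 𝓕 F → DimGe (T ∩ F) t

  TauLe : ℕ → Fam → ℕ → Set₁
  TauLe t 𝓕 k = Σ Subspace λ T → IsCover t 𝓕 T × DimGe-le T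
    where DimGe-le : Subspace → Set
          DimGe-le T = Σ ℕ λ m → HasDim T m × m ≤ k

  MinCover : ℕ → Fam → Subspace → Set₁
  MinCover t 𝓕 T = IsCover t 𝓕 T × Σ ℕ λ m → HasDim T m
    × (∀ T' m' → IsCover t 𝓕 T' → HasDim T' m' → m ≤ m')

{-# OPTIONS --safe #-}
-- Extend a basis of the minimum t-cover Tf by vectors chosen one at a time outside
-- (span so far) + Tg; there is room because k + dim Tg ≤ 2k ≤ n. The result is a k-space
-- G ⊇ Tf with G ∩ Tg ⊆ Tf. Since G contains the t-cover Tf, it meets every member of 𝓕 in
-- dimension ≥ t, so adjoining G to 𝓖 keeps the pair s-almost cross-t-intersecting, and
-- maximality gives G ∈ 𝓖. As Tg is a t-cover of 𝓖, dim (Tg ∩ G) ≥ t, and Tg ∩ G = Tf ∩ Tg.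
-- Finiteness of 𝔽 enters twice, both times by counting (an injection 𝔽ᵃ → 𝔽ᵇ forces a ≤ b):
-- a span of fewer than n vectors misses some vector, and dimension is monotone.
module Submission where

open import Level using (0ℓ)
open import Algebra.Bundles using (CommutativeRing)
import Algebra.Properties.CommutativeSemigroup as CommutativeSemigroupProperties
import Algebra.Properties.Ring as RingProperties
open import Data.Empty using (⊥-elim)
open import Data.Fin as Fin using (Fin; zero; suc; funToFin; finToFun)
import Data.Fin.Properties as Fin
import Data.List as List
import Data.List.Relation.Unary.All as All
open import Data.Nat as ℕ using (ℕ; zero; suc; z≤n)
import Data.Nat.Properties as ℕ
open import Data.Product using (∃; ∃₂; _×_; _,_; proj₁; proj₂)
open import Data.Sum using (_⊎_; inj₁; inj₂)
open import Data.Vec.Functional using (_∷_; _++_; tail)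
open import Data.Vec.Functional.Properties using (++-injective)
open import Function using (_∘_; _↔_; Inverse)
open import Function.Bundles using (Injection)
open import Function.Properties.Inverse using (↔⇒↣)
open import Relation.Binary.PropositionalEquality
  using (_≡_; _≢_; _≗_; refl; sym; trans; cong; cong₂; subst; module ≡-Reasoning)
open import Relation.Nullary using (¬_; Dec; yes; no; ¬?)
open import Relation.Nullary.Decidable using (map′; decidable-stable; via-injection)

open import Defs

funToFin-cong : ∀ {a m} {f g : Fin a → Fin m} → f ≗ g → funToFin f ≡ funToFin g
funToFin-cong {zero}  f≗g = refl
funToFin-cong {suc a} f≗g = cong₂ Fin.combine (f≗g zero) (funToFin-cong (f≗g ∘ suc))

module FiniteField (𝔽 : Field) {q : ℕ} (enum : Field.Carrier 𝔽 ↔ Fin q) where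
  open Field 𝔽 using (Carrier; 0#; 1#; 0≢1)
  open Inverse enum using (to; from; strictlyInverseˡ; strictlyInverseʳ)
  open Injection (↔⇒↣ enum) using (injective)

  infix 4 _≟_
  _≟_ : (x y : Carrier) → Dec (x ≡ y)
  _≟_ = via-injection (↔⇒↣ enum) Fin._≟_

  1<q : 1 ℕ.< q
  1<q = Fin.injective⇒≤ {f = 0-1} 0-1-injective
    where
      0-1 : Fin 2 → Fin q
      0-1 zero    = to 0#
      0-1 (suc _) = to 1#
      0-1-injective : ∀ {i j} → 0-1 i ≡ 0-1 j → i ≡ j
      0-1-injective {zero}     {zero}     _ = refl
      0-1-injective {zero}     {suc zero} e = ⊥-elim (0≢1 (injective e))
      0-1-injective {suc zero} {zero}     e = ⊥-elim (0≢1 (sym (injective e)))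
      0-1-injective {suc zero} {suc zero} _ = refl

  encode : ∀ {a} → (Fin a → Carrier) → Fin (q ℕ.^ a)
  encode c = funToFin (to ∘ c)

  decode : ∀ {a} → Fin (q ℕ.^ a) → Fin a → Carrier
  decode {a} i = from ∘ finToFun {q} {a} i

  decode-encode : ∀ {a} (c : Fin a → Carrier) → decode (encode c) ≗ c
  decode-encode c j = trans (cong from (Fin.finToFun-funToFin (to ∘ c) j)) (strictlyInverseʳ (c j))

  decode-injective : ∀ {a} {i j : Fin (q ℕ.^ a)} → decode i ≗ decode j → i ≡ j
  decode-injective {a} {i} {j} e = begin
    i                              ≡⟨ Fin.funToFin-finToFin {a} i ⟨
    funToFin (finToFun {q} {a} i)  ≡⟨ funToFin-cong {a} (λ k → trans (sym (strictlyInverseˡ _))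
                                                       (trans (cong to (e k)) (strictlyInverseˡ _))) ⟩
    funToFin (finToFun {q} {a} j)  ≡⟨ Fin.funToFin-finToFin {a} j ⟩
    j                              ∎
    where open ≡-Reasoning

  injection⇒≤ : ∀ {a b} (h : (Fin a → Carrier) → (Fin b → Carrier))
              → (∀ {c c'} → h c ≗ h c' → c ≗ c') → a ℕ.≤ b
  injection⇒≤ {a} {b} h h-injective = ℕ.≮⇒≥ (λ b<a → ℕ.<⇒≱ (ℕ.^-monoʳ-< q 1<q b<a) q^a≤q^b)
    where
      encoded : Fin (q ℕ.^ a) → Fin (q ℕ.^ b)
      encoded = encode ∘ h ∘ decode {a}
      q^a≤q^b : q ℕ.^ a ℕ.≤ q ℕ.^ b
      q^a≤q^b = Fin.injective⇒≤ {f = encoded} λ {i} {j} e →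
        decode-injective {a} (h-injective (λ k → begin
        h (decode i) k        ≡⟨ decode-encode (h (decode i)) k ⟨
        decode (encoded i) k  ≡⟨ cong (λ l → decode {b} l k) e ⟩
        decode (encoded j) k  ≡⟨ decode-encode (h (decode j)) k ⟩
        h (decode j) k        ∎))
        where open ≡-Reasoning

  ∃? : ∀ {a} {P : (Fin a → Carrier) → Set} → (∀ {c c'} → c ≗ c' → P c → P c')
     → (∀ c → Dec (P c)) → Dec (∃ P)
  ∃? {a} P-resp P? = map′ (λ (i , p) → decode i , p)
                      (λ (c , p) → encode c , P-resp (λ j → sym (decode-encode c j)) p)
                      (Fin.any? (P? ∘ decode {a}))

module Linear (𝔽 : Field) (n : ℕ) where
  open LinAlg 𝔽 n

  commutativeRing : CommutativeRing 0ℓ 0ℓ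
  commutativeRing = record
    { Carrier = Field.Carrier 𝔽 ; _≈_ = _≡_ ; _+_ = Field._+_ 𝔽 ; _*_ = Field._*_ 𝔽
    ; -_ = Field.-_ 𝔽 ; 0# = Field.0# 𝔽 ; 1# = Field.1# 𝔽
    ; isCommutativeRing = Field.isCommutativeRing 𝔽 }

  open CommutativeRing commutativeRing
    using ( Carrier; _+_; _*_; -_; _-_; 0#; 1#; +-assoc; +-comm; +-identityˡ; +-identityʳ
          ; -‿inverseˡ; -‿inverseʳ; *-assoc; *-comm; *-identityˡ; zeroˡ; zeroʳ; distribˡ; distribʳ
          ; +-commutativeSemigroup; ring )
  open CommutativeSemigroupProperties +-commutativeSemigroup using (interchange)
  open RingProperties ring using (-0#≈0#; -‿+-comm; -‿distribˡ-*; x∙y⁻¹≈ε⇒x≈y)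

  infix 4 _∈_ _⊆ₛ_

  _∈_ : V → Subspace → Set
  v ∈ U = _∈S U v

  _⊆ₛ_ : Subspace → Subspace → Set
  U ⊆ₛ W = ∀ v → v ∈ U → v ∈ W

  lincomb-cong : ∀ d {c c'} (b : Fin d → V) → c ≗ c' → lincomb d c b ≈V lincomb d c' b
  lincomb-cong zero    b c≗c' i = refl
  lincomb-cong (suc d) b c≗c' i =
    cong₂ _+_ (cong (_* b zero i) (c≗c' zero)) (lincomb-cong d (tail b) (c≗c' ∘ suc) i)

  lincomb-0 : ∀ d {c} (b : Fin d → V) → (∀ j → c j ≡ 0#) → lincomb d c b ≈V 0V
  lincomb-0 zero    b c≡0 i = refl
  lincomb-0 (suc d) b c≡0 i = begin
    _ * b zero i + lincomb d _ (tail b) i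
      ≡⟨ cong₂ _+_ (cong (_* b zero i) (c≡0 zero)) (lincomb-0 d (tail b) (c≡0 ∘ suc) i) ⟩
    0# * b zero i + 0#                     ≡⟨ +-identityʳ _ ⟩
    0# * b zero i                          ≡⟨ zeroˡ _ ⟩
    0#                                     ∎
    where open ≡-Reasoning

  lincomb-+ : ∀ d c c' (b : Fin d → V)
            → lincomb d (λ j → c j + c' j) b ≈V (lincomb d c b +V lincomb d c' b)
  lincomb-+ zero    c c' b i = sym (+-identityˡ 0#)
  lincomb-+ (suc d) c c' b i = begin
    (c zero + c' zero) * b₀ + lincomb d _ (tail b) i
      ≡⟨ cong₂ _+_ (distribʳ b₀ (c zero) (c' zero)) (lincomb-+ d (tail c) (tail c') (tail b) i) ⟩
    (c zero * b₀ + c' zero * b₀) + (rest c + rest c')  ≡⟨ interchange _ _ _ _ ⟩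
    (c zero * b₀ + rest c) + (c' zero * b₀ + rest c')  ∎
    where
      open ≡-Reasoning
      b₀ : Carrier
      b₀ = b zero i
      rest : (Fin (suc d) → Carrier) → Carrier
      rest e = lincomb d (tail e) (tail b) i

  lincomb-* : ∀ d a c (b : Fin d → V) → lincomb d (λ j → a * c j) b ≈V (a ·V lincomb d c b)
  lincomb-* zero    a c b i = sym (zeroʳ a)
  lincomb-* (suc d) a c b i = begin
    a * c zero * b zero i + lincomb d (λ j → a * c (suc j)) (tail b) i
      ≡⟨ cong₂ _+_ (*-assoc a (c zero) (b zero i)) (lincomb-* d a (tail c) (tail b) i) ⟩
    a * (c zero * b zero i) + a * lincomb d (tail c) (tail b) i
      ≡⟨ distribˡ a _ _ ⟨
    a * (c zero * b zero i + lincomb d (tail c) (tail b) i)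
      ∎
    where open ≡-Reasoning

  lincomb-neg : ∀ d c (b : Fin d → V) → lincomb d (λ j → - c j) b ≈V (λ i → - lincomb d c b i)
  lincomb-neg zero    c b i = sym -0#≈0#
  lincomb-neg (suc d) c b i = begin
    - c zero * b zero i + lincomb d (λ j → - c (suc j)) (tail b) i
      ≡⟨ cong₂ _+_ (sym (-‿distribˡ-* (c zero) (b zero i))) (lincomb-neg d (tail c) (tail b) i) ⟩
    - (c zero * b zero i) + - lincomb d (tail c) (tail b) i
      ≡⟨ -‿+-comm _ _ ⟩
    - (c zero * b zero i + lincomb d (tail c) (tail b) i)
      ∎
    where open ≡-Reasoning

  lincomb-tail : ∀ d c (b : Fin (suc d) → V) → c zero ≡ 0#
               → lincomb (suc d) c b ≈V lincomb d (tail c) (tail b)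
  lincomb-tail d c b c₀≡0 i = begin
    _ * b zero i + lincomb d _ (tail b) i   ≡⟨ cong (λ a → a * b zero i + lincomb d _ (tail b) i) c₀≡0 ⟩
    0# * b zero i + lincomb d _ (tail b) i  ≡⟨ cong (_+ lincomb d _ (tail b) i) (zeroˡ _) ⟩
    0# + lincomb d _ (tail b) i             ≡⟨ +-identityˡ _ ⟩
    lincomb d _ (tail b) i                  ∎
    where open ≡-Reasoning

  lincomb-∈ : ∀ (U : Subspace) d c {b : Fin d → V} → (∀ j → b j ∈ U) → lincomb d c b ∈ U
  lincomb-∈ U zero    c b∈U = 0∈ U
  lincomb-∈ U (suc d) c b∈U =
    +∈ U _ _ (·∈ U (c zero) _ (b∈U zero)) (lincomb-∈ U d (tail c) (b∈U ∘ suc))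

  lincomb-injective : ∀ {d} {b : Fin d → V} → LinIndep d b
                    → ∀ {c c'} → lincomb d c b ≈V lincomb d c' b → c ≗ c'
  lincomb-injective {d} {b} independent {c} {c'} eq j =
    x∙y⁻¹≈ε⇒x≈y (c j) (c' j) (independent (λ k → c k - c' k) difference-vanishes j)
    where
      open ≡-Reasoning
      difference-vanishes : lincomb d (λ k → c k - c' k) b ≈V 0V
      difference-vanishes i = begin
        lincomb d (λ k → c k - c' k) b i                    ≡⟨ lincomb-+ d c (λ k → - c' k) b i ⟩
        lincomb d c b i + lincomb d (λ k → - c' k) b i      ≡⟨ cong₂ _+_ (eq i) (lincomb-neg d c' b i) ⟩
        lincomb d c' b i - lincomb d c' b i                 ≡⟨ -‿inverseʳ _ ⟩
        0#                                                  ∎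

  Span : (d : ℕ) → (Fin d → V) → Subspace
  Span d b = record
    { _∈S    = λ v → ∃ λ c → lincomb d c b ≈V v
    ; ∈-resp = λ u v u≈v (c , eq) → c , (λ i → trans (eq i) (u≈v i))
    ; 0∈     = (λ _ → 0#) , lincomb-0 d b (λ _ → refl)
    ; +∈     = λ u v (c , eq) (c' , eq') →
                 (λ j → c j + c' j) , λ i → trans (lincomb-+ d c c' b i) (cong₂ _+_ (eq i) (eq' i))
    ; ·∈     = λ a v (c , eq) → (λ j → a * c j) , λ i → trans (lincomb-* d a c b i) (cong (a *_) (eq i))
    }

  Span-tail : ∀ d (b : Fin (suc d) → V) → Span d (tail b) ⊆ₛ Span (suc d) b
  Span-tail d b v (c , eq) = (0# ∷ c) , λ i → trans (lincomb-tail d (0# ∷ c) b refl i) (eq i)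

  generator-∈-Span : ∀ d (b : Fin d → V) j → b j ∈ Span d b
  generator-∈-Span (suc d) b zero    = (1# ∷ λ _ → 0#) , λ i → begin
    1# * b zero i + lincomb d (λ _ → 0#) (tail b) i
      ≡⟨ cong (1# * b zero i +_) (lincomb-0 d (tail b) (λ _ → refl) i) ⟩
    1# * b zero i + 0#  ≡⟨ +-identityʳ _ ⟩
    1# * b zero i       ≡⟨ *-identityˡ _ ⟩
    b zero i            ∎
    where open ≡-Reasoning
  generator-∈-Span (suc d) b (suc j) = Span-tail d b _ (generator-∈-Span d (tail b) j)

  Span-HasDim : ∀ {d} {b : Fin d → V} → LinIndep d b → HasDim (Span d b) d
  Span-HasDim {d} {b} independent = b , generator-∈-Span d b , independent , λ v v∈Span → v∈Span

  ≐-refl : ∀ {U} → U ≐ U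
  ≐-refl v = (λ v∈U → v∈U) , (λ v∈U → v∈U)

  ≐-sym : ∀ {U W} → U ≐ W → W ≐ U
  ≐-sym U≐W v = proj₂ (U≐W v) , proj₁ (U≐W v)

  ≐-trans : ∀ {U W X} → U ≐ W → W ≐ X → U ≐ X
  ≐-trans U≐W W≐X v = proj₁ (W≐X v) ∘ proj₁ (U≐W v) , proj₂ (U≐W v) ∘ proj₂ (W≐X v)

  HasDim-resp-≐ : ∀ {U W d} → U ≐ W → HasDim U d → HasDim W d
  HasDim-resp-≐ U≐W (b , b∈U , independent , spans) =
    b , (λ j → proj₁ (U≐W (b j)) (b∈U j)) , independent , (λ v → spans v ∘ proj₂ (U≐W v))

  DimGe-resp-≐ : ∀ {U W t} → U ≐ W → DimGe U t → DimGe W t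
  DimGe-resp-≐ {U} {W} U≐W (d , dimU , t≤d) = d , HasDim-resp-≐ {U} {W} U≐W dimU , t≤d

  infix 4 _∈_⊞_

  _∈_⊞_ : V → Subspace → Subspace → Set
  x ∈ U ⊞ W = ∃₂ λ u w → u ∈ U × w ∈ W × (u +V w) ≈V x

  ⊞-monoʳ : ∀ {x U W W'} → W ⊆ₛ W' → x ∈ U ⊞ W → x ∈ U ⊞ W'
  ⊞-monoʳ W⊆W' (u , w , u∈U , w∈W , u+w≈x) = u , w , u∈U , W⊆W' w w∈W , u+w≈x

  y*a≡1⇒-ys+y[ax+s]≡x : ∀ {a y} → y * a ≡ 1# → ∀ x s → - y * s + y * (a * x + s) ≡ x
  y*a≡1⇒-ys+y[ax+s]≡x {a} {y} ya≡1 x s = begin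
    - y * s + y * (a * x + s)        ≡⟨ cong (- y * s +_) (trans (distribˡ y (a * x) s) (+-comm _ _)) ⟩
    - y * s + (y * s + y * (a * x))  ≡⟨ +-assoc _ _ _ ⟨
    (- y * s + y * s) + y * (a * x)  ≡⟨ cong (_+ y * (a * x)) (distribʳ s (- y) y) ⟨
    (- y + y) * s + y * (a * x)      ≡⟨ cong (λ z → z * s + y * (a * x)) (-‿inverseˡ y) ⟩
    0# * s + y * (a * x)             ≡⟨ cong (_+ y * (a * x)) (zeroˡ s) ⟩
    0# + y * (a * x)                 ≡⟨ +-identityˡ _ ⟩
    y * (a * x)                      ≡⟨ *-assoc y a x ⟨
    y * a * x                        ≡⟨ cong (_* x) ya≡1 ⟩
    1# * x                           ≡⟨ *-identityˡ x ⟩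
    x                                ∎
    where open ≡-Reasoning

  head-∈-⊞ : ∀ d c (x : V) (b : Fin d → V) {W} → c zero ≢ 0#
           → lincomb (suc d) c (x ∷ b) ∈ W → x ∈ Span d b ⊞ W
  head-∈-⊞ d c x b {W} c₀≢0 v∈W with Field.inverse 𝔽 (c zero) c₀≢0
  ... | y , c₀y≡1 =
    (- y) ·V s , y ·V v , ·∈ (Span d b) (- y) s (tail c , λ _ → refl) , ·∈ W y v v∈W ,
    λ i → y*a≡1⇒-ys+y[ax+s]≡x (trans (*-comm y (c zero)) c₀y≡1) (x i) (s i)
    where
      s v : V
      s = lincomb d (tail c) b
      v = lincomb (suc d) c (x ∷ b)

module Counting (𝔽 : Field) {q : ℕ} (enum : Field.Carrier 𝔽 ↔ Fin q) (n : ℕ) where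
  open Field 𝔽 using (Carrier; _+_)
  open LinAlg 𝔽 n
  open Linear 𝔽 n
  open FiniteField 𝔽 enum

  _≈V?_ : (u v : V) → Dec (u ≈V v)
  u ≈V? v = Fin.all? (λ i → u i ≟ v i)

  dim-mono : ∀ {U W d d'} → U ⊆ₛ W → HasDim U d → HasDim W d' → d ℕ.≤ d'
  dim-mono {U} {W} {d} {d'} U⊆W (u , u∈U , u-independent , _) (w , _ , _ , w-spans) =
    injection⇒≤ coordinates λ {c} {c'} e → lincomb-injective u-independent λ i → begin
      lincomb d c u i                  ≡⟨ proj₂ (expansion c) i ⟨
      lincomb d' (coordinates c) w i   ≡⟨ lincomb-cong d' w e i ⟩
      lincomb d' (coordinates c') w i  ≡⟨ proj₂ (expansion c') i ⟩
      lincomb d c' u i                 ∎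
    where
      open ≡-Reasoning
      expansion : ∀ c → ∃ λ c' → lincomb d' c' w ≈V lincomb d c u
      expansion c = w-spans _ (U⊆W _ (lincomb-∈ U d c u∈U))
      coordinates : (Fin d → Carrier) → Fin d' → Carrier
      coordinates = proj₁ ∘ expansion

  DimGe⇒¬DimLt : ∀ {U W t} → U ⊆ₛ W → DimGe U t → ¬ DimLt W t
  DimGe⇒¬DimLt {U} {W} U⊆W (d , dimU , t≤d) (d' , dimW , d'<t) =
    ℕ.<⇒≱ (ℕ.<-≤-trans d'<t t≤d) (dim-mono {U} {W} U⊆W dimU dimW)

  ⊞-Span⇒lincomb : ∀ {a b} {u : Fin a → V} {w : Fin b → V} {x} → x ∈ Span a u ⊞ Span b w
                 → ∃₂ λ c c' → (lincomb a c u +V lincomb b c' w) ≈V x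
  ⊞-Span⇒lincomb (_ , _ , (c , c≈) , (c' , c'≈) , sum≈x) =
    c , c' , λ i → trans (cong₂ _+_ (c≈ i) (c'≈ i)) (sum≈x i)

  ∈-Span⊞Span? : ∀ {a b} (u : Fin a → V) (w : Fin b → V) x → Dec (x ∈ Span a u ⊞ Span b w)
  ∈-Span⊞Span? {a} {b} u w x =
    map′ (λ (c , c' , sum≈x) → _ , _ , (c , λ _ → refl) , (c' , λ _ → refl) , sum≈x) ⊞-Span⇒lincomb
      (∃? (λ c≗d (c' , sum≈x) → c' , λ i → trans (cong (_+ _) (sym (lincomb-cong a u c≗d i))) (sum≈x i))
          λ c → ∃? (λ c'≗d' sum≈x i → trans (cong (_ +_) (sym (lincomb-cong b w c'≗d' i))) (sum≈x i))
                  λ c' → (lincomb a c u +V lincomb b c' w) ≈V? x)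

  ∃-outside-⊞ : ∀ {a b} (u : Fin a → V) (w : Fin b → V) → a ℕ.+ b ℕ.< n
              → ∃ λ x → ¬ x ∈ Span a u ⊞ Span b w
  ∃-outside-⊞ {a} {b} u w a+b<n with ∃? ∉-resp (λ x → ¬? (∈-Span⊞Span? u w x))
    where
      ∉-resp : ∀ {x y} → x ≗ y → ¬ x ∈ Span a u ⊞ Span b w → ¬ y ∈ Span a u ⊞ Span b w
      ∉-resp x≗y x∉ (p , r , p∈ , r∈ , sum≈y) =
        x∉ (p , r , p∈ , r∈ , λ i → trans (sum≈y i) (sym (x≗y i)))
  ... | yes outside = outside
  ... | no ∄ = ⊥-elim (ℕ.<⇒≱ a+b<n (injection⇒≤ coordinates coordinates-injective))
    where
      expansion : ∀ x → ∃₂ λ c c' → (lincomb a c u +V lincomb b c' w) ≈V x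
      expansion x = ⊞-Span⇒lincomb (decidable-stable (∈-Span⊞Span? u w x) (λ x∉ → ∄ (x , x∉)))
      coordinates : V → Fin (a ℕ.+ b) → Carrier
      coordinates x = let (c , c' , _) = expansion x in c ++ c'
      coordinates-injective : ∀ {x y} → coordinates x ≗ coordinates y → x ≗ y
      coordinates-injective {x} {y} eq i =
        let (c , c' , x≈) = expansion x
            (d , d' , y≈) = expansion y
            (c≗d , c'≗d') = ++-injective c d eq
        in begin
          x i                                 ≡⟨ x≈ i ⟨
          lincomb a c u i + lincomb b c' w i
            ≡⟨ cong₂ _+_ (lincomb-cong a u c≗d i) (lincomb-cong b w c'≗d' i) ⟩
          lincomb a d u i + lincomb b d' w i  ≡⟨ y≈ i ⟩
          y i                                 ∎
        where open ≡-Reasoning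

module Extensions (𝔽 : Field) {q : ℕ} (enum : Field.Carrier 𝔽 ↔ Fin q) (n : ℕ) where
  open Field 𝔽 using (0#)
  open LinAlg 𝔽 n
  open Linear 𝔽 n
  open FiniteField 𝔽 enum using (_≟_)
  open Counting 𝔽 enum n using (∃-outside-⊞)

  record Extension (U W : Subspace) (d : ℕ) : Set where
    field
      basis       : Fin d → V
      independent : LinIndep d basis
      ⊇U          : U ⊆ₛ Span d basis
      ∩W⊆U        : (Span d basis ∩ W) ⊆ₛ U

  HasDim⇒Extension : ∀ {U W m} → HasDim U m → Extension U W m
  HasDim⇒Extension {U} {W} {m} (f , f∈U , f-independent , f-spans) = record
    { basis       = f
    ; independent = f-independent
    ; ⊇U          = f-spans
    ; ∩W⊆U        = λ v ((c , c≈v) , _) → ∈-resp U _ v c≈v (lincomb-∈ U m c f∈U)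
    }

  extend : ∀ {U W d b} (w : Fin b → V) → W ⊆ₛ Span b w → d ℕ.+ b ℕ.< n
         → Extension U W d → Extension U W (suc d)
  extend {U} {W} {d} {b} w W⊆Span room E with ∃-outside-⊞ (Extension.basis E) w room
  ... | x , x∉ = record
    { basis       = x ∷ basis
    ; independent = independent′
    ; ⊇U          = λ v → Span-tail d (x ∷ basis) v ∘ ⊇U v
    ; ∩W⊆U        = ∩W⊆U′
    }
    where
      open Extension E
      head≡0 : ∀ c → lincomb (suc d) c (x ∷ basis) ∈ W → c zero ≡ 0#
      head≡0 c v∈W with c zero ≟ 0#
      ... | yes c₀≡0 = c₀≡0
      ... | no  c₀≢0 = ⊥-elim (x∉ (⊞-monoʳ {x} {Span d basis} {W} {Span b w} W⊆Span
                                    (head-∈-⊞ d c x basis {W} c₀≢0 v∈W)))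
      drop-head : ∀ c {v} → lincomb (suc d) c (x ∷ basis) ≈V v → v ∈ W → lincomb d (tail c) basis ≈V v
      drop-head c c≈v v∈W i =
        trans (sym (lincomb-tail d c (x ∷ basis) (head≡0 c (∈-resp W _ _ (sym ∘ c≈v) v∈W)) i)) (c≈v i)
      independent′ : LinIndep (suc d) (x ∷ basis)
      independent′ c c≈0 zero    = head≡0 c (∈-resp W _ _ (sym ∘ c≈0) (0∈ W))
      independent′ c c≈0 (suc j) = independent (tail c) (drop-head c c≈0 (0∈ W)) j
      ∩W⊆U′ : (Span (suc d) (x ∷ basis) ∩ W) ⊆ₛ U
      ∩W⊆U′ v ((c , c≈v) , v∈W) = ∩W⊆U v ((tail c , drop-head c c≈v v∈W) , v∈W)

  extension : ∀ {U W m b k} → HasDim U m → (w : Fin b → V) → W ⊆ₛ Span b w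
            → m ℕ.≤ k → k ℕ.+ b ℕ.≤ n → Extension U W k
  extension {U} {W} {m} {b} {k} dimU w W⊆Span m≤k room =
    subst (Extension U W) k∸m+m≡k (grow (k ℕ.∸ m) (subst (λ d → d ℕ.+ b ℕ.≤ n) (sym k∸m+m≡k) room))
    where
      k∸m+m≡k : k ℕ.∸ m ℕ.+ m ≡ k
      k∸m+m≡k = ℕ.m∸n+n≡m m≤k
      grow : ∀ j → j ℕ.+ m ℕ.+ b ℕ.≤ n → Extension U W (j ℕ.+ m)
      grow zero    _    = HasDim⇒Extension dimU
      grow (suc j) room = extend w W⊆Span room (grow j (ℕ.≤-trans (ℕ.n≤1+n _) room))

module MaximalPairs (𝔽 : Field) {q : ℕ} (enum : Field.Carrier 𝔽 ↔ Fin q) (n : ℕ) where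
  open LinAlg 𝔽 n
  open Linear 𝔽 n
  open Counting 𝔽 enum n using (DimGe⇒¬DimLt)

  AtMost-mono : ∀ {s 𝓟 𝓠} → 𝓟 ⊆ 𝓠 → AtMost s 𝓠 → AtMost s 𝓟
  AtMost-mono 𝓟⊆𝓠 𝓠-small xs xs∈𝓟 distinct = 𝓠-small xs (All.map (𝓟⊆𝓠 _) xs∈𝓟) distinct

  AtMost-empty : ∀ {s 𝓟} → (∀ U → ¬ 𝓟 U) → AtMost s 𝓟
  AtMost-empty 𝓟-empty List.[]       _               _ = z≤n
  AtMost-empty 𝓟-empty (U List.∷ _) (U∈𝓟 All.∷ _) _ = ⊥-elim (𝓟-empty U U∈𝓟)

  superspace-of-cover∈maximal : ∀ {k s t 𝓕 𝓖 T G} → IsFamily k 𝓕 → IsFamily k 𝓖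
    → AlmostCrossInt s t 𝓕 𝓖 → Maximal k s t 𝓕 𝓖 → IsCover t 𝓕 T → T ⊆ₛ G → HasDim G k → 𝓖 G
  superspace-of-cover∈maximal {k} {s} {t} {𝓕} {𝓖} {T} {G}
    𝓕-family (𝓖-dim , 𝓖-closed) (𝓕-small , 𝓖-small) maximal T-cover T⊆G dimG =
    proj₂ (maximal 𝓕 𝓖′ 𝓕-family (𝓖′-dim , 𝓖′-closed) (𝓕-small′ , 𝓖′-small) (λ _ F∈𝓕 → F∈𝓕) (λ _ → inj₁))
      G (inj₂ (≐-refl {G}))
    where
      𝓖′ : Fam
      𝓖′ H = 𝓖 H ⊎ H ≐ G
      𝓖′-dim : ∀ H → 𝓖′ H → HasDim H k
      𝓖′-dim H (inj₁ H∈𝓖) = 𝓖-dim H H∈𝓖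
      𝓖′-dim H (inj₂ H≐G) = HasDim-resp-≐ {G} {H} (≐-sym {H} {G} H≐G) dimG
      𝓖′-closed : ∀ H H′ → H ≐ H′ → 𝓖′ H → 𝓖′ H′
      𝓖′-closed H H′ H≐H′ (inj₁ H∈𝓖) = inj₁ (𝓖-closed H H′ H≐H′ H∈𝓖)
      𝓖′-closed H H′ H≐H′ (inj₂ H≐G) = inj₂ (≐-trans {H′} {H} {G} (≐-sym {H} {H′} H≐H′) H≐G)
      T⊆H : ∀ H → H ≐ G → T ⊆ₛ H
      T⊆H H H≐G v = proj₂ (H≐G v) ∘ T⊆G v
      𝓕-small′ : ∀ F → 𝓕 F → AtMost s (D 𝓖′ F t)
      𝓕-small′ F F∈𝓕 = AtMost-mono D𝓖′⊆D𝓖 (𝓕-small F F∈𝓕)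
        where
          D𝓖′⊆D𝓖 : D 𝓖′ F t ⊆ D 𝓖 F t
          D𝓖′⊆D𝓖 H (inj₁ H∈𝓖 , H∩F<t) = H∈𝓖 , H∩F<t
          D𝓖′⊆D𝓖 H (inj₂ H≐G , H∩F<t) = ⊥-elim (DimGe⇒¬DimLt {T ∩ F} {H ∩ F}
            (λ v (v∈T , v∈F) → T⊆H H H≐G v v∈T , v∈F) (T-cover F F∈𝓕) H∩F<t)
      𝓖′-small : ∀ H → 𝓖′ H → AtMost s (D 𝓕 H t)
      𝓖′-small H (inj₁ H∈𝓖) = 𝓖-small H H∈𝓖
      𝓖′-small H (inj₂ H≐G) = AtMost-empty λ F (F∈𝓕 , F∩H<t) → DimGe⇒¬DimLt {T ∩ F} {F ∩ H}
        (λ v (v∈T , v∈F) → v∈F , T⊆H H H≐G v v∈T) (T-cover F F∈𝓕) F∩H<t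

open import Data.Nat using (_≤_; _+_; _*_; _∸_)

k+m≤n : ∀ {k m s n} → m ≤ k → 1 ≤ s → (2 * k + s) ∸ 1 ≤ n → k + m ≤ n
k+m≤n {k} {m} {s} {n} m≤k 1≤s room = begin
  k + m            ≤⟨ ℕ.+-monoʳ-≤ k m≤k ⟩
  k + k            ≡⟨ cong (k +_) (ℕ.+-identityʳ k) ⟨
  2 * k            ≤⟨ ℕ.m≤m+n (2 * k) (s ∸ 1) ⟩
  2 * k + (s ∸ 1)  ≡⟨ ℕ.+-∸-assoc (2 * k) 1≤s ⟨
  (2 * k + s) ∸ 1  ≤⟨ room ⟩
  n                ∎
  where open ℕ.≤-Reasoning

lemma3p5 : (𝔽 : Field) (q : ℕ) → IsPrimePower q → Field.Carrier 𝔽 ↔ Fin q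
    → (n k t s : ℕ) → 1 ≤ n → 1 ≤ k → 1 ≤ t → 1 ≤ s
    → t + 1 ≤ k → (2 * k + s) ∸ 1 ≤ n
    → let open LinAlg 𝔽 n in
      (𝓕 𝓖 : Fam) → IsFamily k 𝓕 → IsFamily k 𝓖
    → NonEmpty 𝓕 → NonEmpty 𝓖
    → AlmostCrossInt s t 𝓕 𝓖 → Maximal k s t 𝓕 𝓖
    → TauLe t 𝓕 k → TauLe t 𝓖 k
    → ∀ Tf Tg → MinCover t 𝓕 Tf → MinCover t 𝓖 Tg → DimGe (Tf ∩ Tg) t
lemma3p5 𝔽 q _ enum n k t s _ _ _ 1≤s _ room 𝓕 𝓖 𝓕-family 𝓖-family _ _ cross maximal
  (T₁ , T₁-cover , k₁ , dimT₁ , k₁≤k) (T₂ , T₂-cover , k₂ , dimT₂ , k₂≤k)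
  Tf Tg (Tf-cover , m , dimTf , Tf-minimal) (Tg-cover , m′ , (g , _ , _ , g-spans) , Tg-minimal) =
  DimGe-resp-≐ {Tg ∩ G} {Tf ∩ Tg} Tg∩G≐Tf∩Tg (Tg-cover G G∈𝓖)
  where
    open LinAlg 𝔽 n
    open Linear 𝔽 n using (Span; Span-HasDim; DimGe-resp-≐)
    open Extensions 𝔽 enum n using (Extension; extension)
    open MaximalPairs 𝔽 enum n using (superspace-of-cover∈maximal)
    m≤k : m ≤ k
    m≤k = ℕ.≤-trans (Tf-minimal T₁ k₁ T₁-cover dimT₁) k₁≤k
    m′≤k : m′ ≤ k
    m′≤k = ℕ.≤-trans (Tg-minimal T₂ k₂ T₂-cover dimT₂) k₂≤k
    E : Extension Tf Tg k
    E = extension dimTf g g-spans m≤k (k+m≤n m′≤k 1≤s room)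
    open Extension E
    G : Subspace
    G = Span k basis
    G∈𝓖 : 𝓖 G
    G∈𝓖 = superspace-of-cover∈maximal {T = Tf} {G = G}
            𝓕-family 𝓖-family cross maximal Tf-cover ⊇U (Span-HasDim independent)
    Tg∩G≐Tf∩Tg : (Tg ∩ G) ≐ (Tf ∩ Tg)
    Tg∩G≐Tf∩Tg v = (λ (v∈Tg , v∈G) → ∩W⊆U v (v∈G , v∈Tg) , v∈Tg)
                 , (λ (v∈Tf , v∈Tg) → v∈Tg , ⊇U v v∈Tf)
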